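{- Let $p$ be a prime and $e\geq 2$, $d\geq 2$ integers. Let $S$ be a non-empty set of vertices of $\mathcal P(p^e,d)$ (each vertex written as $(p^{\beta_1},\dots,p^{\beta_d})$ with $\beta_i\in\mathbb Z_{\geq0}$, $\sum_i\beta_i=e$), and for $i=1,\dots,d$ let $m_i=\min\beta_i$ and $M_i=\max\beta_i$, the minimum and maximum taken over the elements $(p^{\beta_1},\dots,p^{\beta_d})$ of $S$. Put $m=(m_1,\dots,m_d)$, $M=(M_1,\dots,M_d)$. If $M-m\in\{0,1\}^d$, then $S$ is contained in the set of vertices of a regular facet of $\mathcal P(p^e,d)$.
   Context: $\mathcal P(p^e,d)$ denotes the convex hull in $\mathbb R^d$ of all vectors $(v_1,\dots,v_d)$ of positive integers with $v_1\cdots v_d=p^e$; its vertices are exactly these vectors. For $\lambda\in\{1,\dots,\min(e,d-1)\}$, $\mathcal R_\lambda(d,e)$ is the set of all $\alpha=(\alpha_1,\dots,\alpha_d)$ with non-negative integer entries such that $\min_i\alpha_i=0$, $d\cdot\max_i\alpha_i<e+\sum_{i=1}^d\alpha_i$, and $e+\sum_{i=1}^d\alpha_i\equiv\lambda\pmod d$; for such $\alpha$, $\mu(\alpha)$ is defined by $\mu(\alpha)d+\lambda=e+\sum_i\alpha_i$. For such $\alpha$, the regular facet $F_\alpha$ is the face $\{x\in\mathcal P(p^e,d) : \sum_{i=1}^d p^{\alpha_i}x_i=\lambda p^{\mu(\alpha)+1}+(d-\lambda)p^{\mu(\alpha)}\}$ (the inequality $\sum_i p^{\alpha_i}x_i\ge\lambda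 p^{\mu(\alpha)+1}+(d-\lambda)p^{\mu(\alpha)}$ holds on $\mathcal P(p^e,d)$ and this face is a facet); a regular facet is any $F_\alpha$ with $\alpha\in\mathcal R_\lambda(d,e)$ for some $\lambda\in\{1,\dots,\min(e,d-1)\}$. -}

module Defs where

open import Data.Nat using (ℕ; zero; suc; _+_; _*_; _∸_; _^_; _≤_; _<_; _⊓_; _⊔_)
open import Data.Fin using (Fin)
import Data.Fin as F
open import Data.List.NonEmpty using (List⁺; foldr₁; map)
open import Data.Product using (∃)
open import Relation.Binary.PropositionalEquality using (_≡_)

sumFin : ∀ {d} → (Fin d → ℕ) → ℕ
sumFin {zero} f = 0
sumFin {suc d} f = f F.zero + sumFin (λ i → f (F.suc i))

-- An exponent vector β encodes the vector (p^β₁,…,p^β_d);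
-- it is a vertex of P(p^e,d) iff Σ βᵢ = e.
IsVertexExp : (d e : ℕ) → (Fin d → ℕ) → Set
IsVertexExp d e β = sumFin β ≡ e

minAt : ∀ {d} → List⁺ (Fin d → ℕ) → Fin d → ℕ
minAt S i = foldr₁ _⊓_ (map (λ β → β i) S)

maxAt : ∀ {d} → List⁺ (Fin d → ℕ) → Fin d → ℕ
maxAt S i = foldr₁ _⊔_ (map (λ β → β i) S)

-- Data of a regular facet F_α with α ∈ R_λ(d,e), λ ∈ {1,…,min(e,d-1)}.
-- μ is the unique natural number with μ·d + λ = e + Σ αᵢ (this equation
-- also encodes the congruence e + Σ αᵢ ≡ λ (mod d)).
record RegularFacet (d e : ℕ) : Set where
  field
    lam     : ℕ
    lam≥1   : 1 ≤ lam
    lam≤e   : lam ≤ e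
    lam≤d-1 : lam ≤ d ∸ 1
    α       : Fin d → ℕ
    minα≡0  : ∃ λ i → α i ≡ 0
    dmax<   : ∀ i → d * α i < e + sumFin α
    μ       : ℕ
    μ-def   : μ * d + lam ≡ e + sumFin α

-- The vertices of the face F_α
-- are exactly the vertices of P(p^e,d) satisfying this equation.
OnFacet : ∀ {d e} (p : ℕ) → RegularFacet d e → (Fin d → ℕ) → Set
OnFacet {d} p F β =
  sumFin (λ i → p ^ α i * p ^ β i) ≡ lam * p ^ suc μ + (d ∸ lam) * p ^ μ
  where open RegularFacet F

-- If every exponent vector of S lies in a unit cube L + {0,1}^d, say with
-- Σ L + λ = e, then each of them is L plus exactly λ unit vectors.  With
-- K = max L and α = K − L, every coordinate contributes p^{αᵢ + βᵢ} ∈ {p^K, p^{K+1}},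
-- and exactly λ of them are p^{K+1}; so all of S lies on F_α with μ = K.
-- Such a cube with 1 ≤ λ ≤ d − 1 exists: take L = m when Σ m < e < Σ m + d;
-- otherwise S is a single vertex c, and L = c minus one unit vector works.
module Submission where

open import Defs
open import Data.Nat
open import Data.Nat.Properties
open import Data.Nat.Primality using (Prime)
open import Data.Nat.Solver using (module +-*-Solver)
open import Data.Fin using (Fin)
import Data.Fin as F
open import Data.List using ([]; _∷_)
import Data.List as List
open import Data.List.NonEmpty using (List⁺; toList; _∷_; foldr₁)
open import Data.List.Membership.Propositional using (_∈_)
open import Data.List.Membership.Propositional.Properties using (∈-map⁺)
open import Data.List.Relation.Unary.All as All using (All)
open import Data.List.Relation.Unary.Any using (here; there)
open import Data.Empty using (⊥-elim)
open import Data.Product using (Σ; _×_; _,_; proj₁; proj₂)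
open import Data.Sum using (_⊎_; inj₁; inj₂)
open import Function using (_∘_)
open import Relation.Binary.PropositionalEquality
open import Relation.Nullary using (yes; no)

open +-*-Solver using (solve; _:+_; _:*_; _:=_)

sumFin-cong : ∀ {d} {f g : Fin d → ℕ} → (∀ i → f i ≡ g i) → sumFin f ≡ sumFin g
sumFin-cong {zero}  f≗g = refl
sumFin-cong {suc d} f≗g = cong₂ _+_ (f≗g F.zero) (sumFin-cong (f≗g ∘ F.suc))

sumFin-+ : ∀ {d} (f g : Fin d → ℕ) → sumFin (λ i → f i + g i) ≡ sumFin f + sumFin g
sumFin-+ {zero}  f g = refl
sumFin-+ {suc d} f g =
  trans (cong (f F.zero + g F.zero +_) (sumFin-+ (f ∘ F.suc) (g ∘ F.suc)))
        (+-+-comm (f F.zero) (g F.zero) (sumFin (f ∘ F.suc)) (sumFin (g ∘ F.suc)))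
  where
  +-+-comm : ∀ a b c x → (a + b) + (c + x) ≡ (a + c) + (b + x)
  +-+-comm = solve 4 (λ a b c x → (a :+ b) :+ (c :+ x) := (a :+ c) :+ (b :+ x)) refl

sumFin-*ʳ : ∀ {d} (f : Fin d → ℕ) c → sumFin (λ i → f i * c) ≡ sumFin f * c
sumFin-*ʳ {zero}  f c = refl
sumFin-*ʳ {suc d} f c =
  trans (cong (f F.zero * c +_) (sumFin-*ʳ (f ∘ F.suc) c))
        (sym (*-distribʳ-+ c (f F.zero) (sumFin (f ∘ F.suc))))

sumFin-const : ∀ {d} c → sumFin {d} (λ _ → c) ≡ d * c
sumFin-const {zero}  c = refl
sumFin-const {suc d} c = cong (c +_) (sumFin-const {d} c)

sumFin-suc : ∀ {d} (f : Fin d → ℕ) → sumFin (suc ∘ f) ≡ d + sumFin f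
sumFin-suc {d} f = trans (sumFin-+ (λ _ → 1) f) (cong (_+ sumFin f) (trans (sumFin-const {d} 1) (*-identityʳ d)))

sumFin-mono-≤ : ∀ {d} {f g : Fin d → ℕ} → (∀ i → f i ≤ g i) → sumFin f ≤ sumFin g
sumFin-mono-≤ {zero}  f≤g = z≤n
sumFin-mono-≤ {suc d} f≤g = +-mono-≤ (f≤g F.zero) (sumFin-mono-≤ (f≤g ∘ F.suc))

≤-pointwise∧sumFin-≥⇒≗ : ∀ {d} {f g : Fin d → ℕ} →
  (∀ i → f i ≤ g i) → sumFin g ≤ sumFin f → ∀ i → f i ≡ g i
≤-pointwise∧sumFin-≥⇒≗ {suc d} {f} {g} f≤g Σg≤Σf i with m≤n⇒m<n∨m≡n (f≤g F.zero)
... | inj₁ f₀<g₀ = ⊥-elim (<⇒≱ (+-mono-<-≤ f₀<g₀ (sumFin-mono-≤ (f≤g ∘ F.suc))) Σg≤Σf)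
... | inj₂ f₀≡g₀ with i
...   | F.zero  = f₀≡g₀
...   | F.suc j = ≤-pointwise∧sumFin-≥⇒≗ (f≤g ∘ F.suc) Σtail-g≤Σtail-f j
  where
  Σtail-g≤Σtail-f : sumFin (g ∘ F.suc) ≤ sumFin (f ∘ F.suc)
  Σtail-g≤Σtail-f = +-cancelˡ-≤ (g F.zero) _ _ (subst (λ a → _ ≤ a + _) f₀≡g₀ Σg≤Σf)

foldr₁-⊓-≤ : ∀ {x} (xs : List⁺ ℕ) → x ∈ toList xs → foldr₁ _⊓_ xs ≤ x
foldr₁-⊓-≤ (y ∷ [])     (here refl) = ≤-refl
foldr₁-⊓-≤ (y ∷ z ∷ zs) (here refl) = m⊓n≤m y (foldr₁ _⊓_ (z ∷ zs))
foldr₁-⊓-≤ (y ∷ z ∷ zs) (there x∈) = ≤-trans (m⊓n≤n y _) (foldr₁-⊓-≤ (z ∷ zs) x∈)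

foldr₁-⊔-≥ : ∀ {x} (xs : List⁺ ℕ) → x ∈ toList xs → x ≤ foldr₁ _⊔_ xs
foldr₁-⊔-≥ (y ∷ [])     (here refl) = ≤-refl
foldr₁-⊔-≥ (y ∷ z ∷ zs) (here refl) = m≤m⊔n y (foldr₁ _⊔_ (z ∷ zs))
foldr₁-⊔-≥ (y ∷ z ∷ zs) (there x∈) = ≤-trans (foldr₁-⊔-≥ (z ∷ zs) x∈) (m≤n⊔m y _)

minAt-≤ : ∀ {d β} (S : List⁺ (Fin d → ℕ)) → β ∈ toList S → ∀ i → minAt S i ≤ β i
minAt-≤ (x ∷ xs) β∈S i = foldr₁-⊓-≤ (x i ∷ List.map (λ β → β i) xs) (∈-map⁺ (λ β → β i) β∈S)

≤-maxAt : ∀ {d β} (S : List⁺ (Fin d → ℕ)) → β ∈ toList S → ∀ i → β i ≤ maxAt S i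
≤-maxAt (x ∷ xs) β∈S i = foldr₁-⊔-≥ (x i ∷ List.map (λ β → β i) xs) (∈-map⁺ (λ β → β i) β∈S)

argmax : ∀ {d} (L : Fin (suc d) → ℕ) → Σ (Fin (suc d)) λ k → ∀ j → L j ≤ L k
argmax {zero}  L = F.zero , λ { F.zero → ≤-refl }
argmax {suc d} L with argmax (L ∘ F.suc)
... | k , L≤Lk with L F.zero ≤? L (F.suc k)
...   | yes L₀≤Lk = F.suc k , λ { F.zero → L₀≤Lk ; (F.suc j) → L≤Lk j }
...   | no  L₀≰Lk = F.zero  , λ { F.zero → ≤-refl ; (F.suc j) → ≤-trans (L≤Lk j) (<⇒≤ (≰⇒> L₀≰Lk)) }

InUnitCube : ∀ {d} → (Fin d → ℕ) → (Fin d → ℕ) → Set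
InUnitCube L β = ∀ i → β i ≡ L i ⊎ β i ≡ suc (L i)

inUnitCube⇒≤ : ∀ {d} {L β : Fin d → ℕ} → InUnitCube L β → ∀ i → L i ≤ β i
inUnitCube⇒≤ β∈L i with β∈L i
... | inj₁ β≡L   = ≤-reflexive (sym β≡L)
... | inj₂ β≡L+1 = ≤-trans (n≤1+n _) (≤-reflexive (sym β≡L+1))

inUnitCube⇒≤suc : ∀ {d} {L β : Fin d → ℕ} → InUnitCube L β → ∀ i → β i ≤ suc (L i)
inUnitCube⇒≤suc β∈L i with β∈L i
... | inj₁ β≡L   = ≤-trans (≤-reflexive β≡L) (n≤1+n _)
... | inj₂ β≡L+1 = ≤-reflexive β≡L+1

inUnitCube-squeeze : ∀ {d} {m M β : Fin d → ℕ} → InUnitCube m M →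
  (∀ i → m i ≤ β i) → (∀ i → β i ≤ M i) → InUnitCube m β
inUnitCube-squeeze M∈m m≤β β≤M i with M∈m i | m≤n⇒m<n∨m≡n (m≤β i)
... | inj₁ M≡m | _           = inj₁ (≤-antisym (subst (_ ≤_) M≡m (β≤M i)) (m≤β i))
... | inj₂ M≡m+1 | inj₁ m<β = inj₂ (≤-antisym (subst (_ ≤_) M≡m+1 (β≤M i)) m<β)
... | inj₂ _     | inj₂ m≡β = inj₁ (sym m≡β)

inUnitCube-resp-≗ : ∀ {d} {L β γ : Fin d → ℕ} → (∀ i → β i ≡ γ i) → InUnitCube L γ → InUnitCube L β
inUnitCube-resp-≗ β≗γ γ∈L i rewrite β≗γ i = γ∈L i

unitCubeBelow : ∀ {d} (c : Fin d → ℕ) → 1 ≤ sumFin c →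
  Σ (Fin d → ℕ) λ L → InUnitCube L c × sumFin L + 1 ≡ sumFin c
unitCubeBelow {suc d} c Σc≥1 with c F.zero in c₀≡
... | suc k = (λ { F.zero → k ; (F.suc i) → c (F.suc i) })
            , (λ { F.zero → inj₂ c₀≡ ; (F.suc i) → inj₁ refl })
            , +-comm (k + sumFin (c ∘ F.suc)) 1
... | zero with unitCubeBelow (c ∘ F.suc) Σc≥1
...   | L , c∈L , ΣL+1≡Σc = (λ { F.zero → 0 ; (F.suc i) → L i })
                          , (λ { F.zero → inj₁ c₀≡ ; (F.suc i) → c∈L i })
                          , ΣL+1≡Σc

-- p^{K−l} p^b is p^K or p^{K+1} according as b = l or b = l + 1, written without subtracting powers.
unitCube-coordinate : ∀ p K l b → l ≤ K → b ≡ l ⊎ b ≡ suc l →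
  p ^ (K ∸ l) * p ^ b + (b ∸ l) * p ^ K ≡ (b ∸ l) * p ^ suc K + p ^ K
unitCube-coordinate p K l .l l≤K (inj₁ refl) rewrite n∸n≡0 l = begin
  p ^ (K ∸ l) * p ^ l + 0  ≡⟨ +-identityʳ _ ⟩
  p ^ (K ∸ l) * p ^ l      ≡⟨ ^-distribˡ-+-* p (K ∸ l) l ⟨
  p ^ (K ∸ l + l)          ≡⟨ cong (p ^_) (m∸n+n≡m l≤K) ⟩
  p ^ K                    ∎
  where open ≡-Reasoning
unitCube-coordinate p K l .(suc l) l≤K (inj₂ refl) rewrite m+n∸n≡m 1 l = begin
  p ^ (K ∸ l) * p ^ suc l + 1 * p ^ K  ≡⟨ cong₂ _+_ (sym (^-distribˡ-+-* p (K ∸ l) (suc l))) (*-identityˡ (p ^ K)) ⟩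
  p ^ (K ∸ l + suc l) + p ^ K          ≡⟨ cong (λ n → p ^ n + p ^ K) (trans (+-suc (K ∸ l) l) (cong suc (m∸n+n≡m l≤K))) ⟩
  p ^ suc K + p ^ K                    ≡⟨ cong (_+ p ^ K) (*-identityˡ (p ^ suc K)) ⟨
  1 * p ^ suc K + p ^ K                ∎
  where open ≡-Reasoning

record UnitCubeSlice (d e : ℕ) : Set where
  field
    corner        : Fin (suc d) → ℕ
    lam           : ℕ
    1≤lam         : 1 ≤ lam
    lam≤d         : lam ≤ d
    Σcorner+lam≡e : sumFin corner + lam ≡ e

unitCubeFacet : ∀ {d e} (p : ℕ) (C : UnitCubeSlice d e) → let open UnitCubeSlice C in
  Σ (RegularFacet (suc d) e) λ F → ∀ {β} → InUnitCube corner β → IsVertexExp (suc d) e β → OnFacet p F β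
unitCubeFacet {d} {e} p C = facet , onFacet
  where
  open UnitCubeSlice C renaming (corner to L; Σcorner+lam≡e to ΣL+lam≡e)
  k = proj₁ (argmax L)
  K = L k
  L≤K = proj₂ (argmax L)

  α : Fin (suc d) → ℕ
  α i = K ∸ L i

  Σα+ΣL≡dK : sumFin α + sumFin L ≡ suc d * K
  Σα+ΣL≡dK = begin
    sumFin α + sumFin L           ≡⟨ sumFin-+ α L ⟨
    sumFin (λ i → K ∸ L i + L i)  ≡⟨ sumFin-cong (λ i → m∸n+n≡m (L≤K i)) ⟩
    sumFin {suc d} (λ _ → K)      ≡⟨ sumFin-const {suc d} K ⟩
    suc d * K                     ∎
    where open ≡-Reasoning

  μ-def : K * suc d + lam ≡ e + sumFin α
  μ-def = begin
    K * suc d + lam                ≡⟨ cong (_+ lam) (trans (*-comm K (suc d)) (sym Σα+ΣL≡dK)) ⟩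
    sumFin α + sumFin L + lam      ≡⟨ +-assoc (sumFin α) (sumFin L) lam ⟩
    sumFin α + (sumFin L + lam)    ≡⟨ +-comm (sumFin α) _ ⟩
    (sumFin L + lam) + sumFin α    ≡⟨ cong (_+ sumFin α) ΣL+lam≡e ⟩
    e + sumFin α                   ∎
    where open ≡-Reasoning

  dα<e+Σα : ∀ i → suc d * α i < e + sumFin α
  dα<e+Σα i = begin-strict
    suc d * α i      ≤⟨ *-monoʳ-≤ (suc d) (m∸n≤m K (L i)) ⟩
    suc d * K        ≡⟨ *-comm (suc d) K ⟩
    K * suc d        <⟨ m<m+n (K * suc d) 1≤lam ⟩
    K * suc d + lam  ≡⟨ μ-def ⟩
    e + sumFin α     ∎
    where open ≤-Reasoning

  facet : RegularFacet (suc d) e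
  facet = record
    { lam = lam ; lam≥1 = 1≤lam ; lam≤e = subst (lam ≤_) ΣL+lam≡e (m≤n+m lam (sumFin L))
    ; lam≤d-1 = lam≤d ; α = α ; minα≡0 = k , n∸n≡0 K ; dmax< = dα<e+Σα ; μ = K ; μ-def = μ-def }

  P Q : ℕ
  P = p ^ K
  Q = p ^ suc K

  onFacet : ∀ {β} → InUnitCube L β → IsVertexExp (suc d) e β → OnFacet p facet β
  onFacet {β} β∈L Σβ≡e = +-cancelʳ-≡ (lam * P) X (lam * Q + (suc d ∸ lam) * P) (begin
    X + lam * P                                ≡⟨ cong (λ n → X + n * P) Σδ≡lam ⟨
    X + sumFin δ * P                           ≡⟨ cong (X +_) (sumFin-*ʳ δ P) ⟨
    X + sumFin (λ i → δ i * P)                 ≡⟨ sumFin-+ (λ i → p ^ α i * p ^ β i) (λ i → δ i * P) ⟨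
    sumFin (λ i → p ^ α i * p ^ β i + δ i * P) ≡⟨ sumFin-cong (λ i → unitCube-coordinate p K (L i) (β i) (L≤K i) (β∈L i)) ⟩
    sumFin (λ i → δ i * Q + P)                 ≡⟨ sumFin-+ (λ i → δ i * Q) (λ _ → P) ⟩
    sumFin (λ i → δ i * Q) + sumFin {suc d} (λ _ → P)
                                               ≡⟨ cong₂ _+_ (sumFin-*ʳ δ Q) (sumFin-const {suc d} P) ⟩
    sumFin δ * Q + suc d * P                   ≡⟨ cong₂ (λ n o → n * Q + o * P) Σδ≡lam (sym (m∸n+n≡m (≤-trans lam≤d (n≤1+n d)))) ⟩
    lam * Q + (suc d ∸ lam + lam) * P          ≡⟨ distribute (lam * Q) (suc d ∸ lam) lam P ⟩
    lam * Q + (suc d ∸ lam) * P + lam * P      ∎)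
    where
    open ≡-Reasoning
    X = sumFin (λ i → p ^ α i * p ^ β i)
    δ : Fin (suc d) → ℕ
    δ i = β i ∸ L i
    Σδ≡lam : sumFin δ ≡ lam
    Σδ≡lam = +-cancelʳ-≡ (sumFin L) _ _ (begin
      sumFin δ + sumFin L             ≡⟨ sumFin-+ δ L ⟨
      sumFin (λ i → β i ∸ L i + L i)  ≡⟨ sumFin-cong (λ i → m∸n+n≡m (inUnitCube⇒≤ β∈L i)) ⟩
      sumFin β                        ≡⟨ trans Σβ≡e (sym ΣL+lam≡e) ⟩
      sumFin L + lam                  ≡⟨ +-comm (sumFin L) lam ⟩
      lam + sumFin L                  ∎)
    distribute : ∀ a b c x → a + (b + c) * x ≡ a + b * x + c * x
    distribute = solve 4 (λ a b c x → a :+ (b :+ c) :* x := a :+ b :* x :+ c :* x) refl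

singleVertexSlice : ∀ {d e} → 1 ≤ d → 1 ≤ e → (c : Fin (suc d) → ℕ) → sumFin c ≡ e →
  Σ (UnitCubeSlice d e) λ C → InUnitCube (UnitCubeSlice.corner C) c
singleVertexSlice 1≤d 1≤e c Σc≡e with unitCubeBelow c (subst (1 ≤_) (sym Σc≡e) 1≤e)
... | L , c∈L , ΣL+1≡Σc = record
  { corner = L ; lam = 1 ; 1≤lam = ≤-refl ; lam≤d = 1≤d ; Σcorner+lam≡e = trans ΣL+1≡Σc Σc≡e } , c∈L

constantSlice : ∀ {d e} → 1 ≤ d → 1 ≤ e → (c : Fin (suc d) → ℕ) (S : List⁺ (Fin (suc d) → ℕ)) →
  All (λ β → (∀ i → β i ≡ c i) × IsVertexExp (suc d) e β) (toList S) →
  Σ (UnitCubeSlice d e) λ C → All (InUnitCube (UnitCubeSlice.corner C)) (toList S)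
constantSlice {e = e} 1≤d 1≤e c S S≗c =
  let C , c∈C = singleVertexSlice 1≤d 1≤e c Σc≡e
  in  C , All.map (λ (β≗c , _) → inUnitCube-resp-≗ β≗c c∈C) S≗c
  where
  Σc≡e : sumFin c ≡ e
  Σc≡e = trans (sumFin-cong (sym ∘ proj₁ (All.head S≗c))) (proj₂ (All.head S≗c))

unitCubeSliceContaining : ∀ {d e} → 1 ≤ d → 1 ≤ e → (m : Fin (suc d) → ℕ) (S : List⁺ (Fin (suc d) → ℕ)) →
  All (λ β → InUnitCube m β × IsVertexExp (suc d) e β) (toList S) →
  Σ (UnitCubeSlice d e) λ C → All (InUnitCube (UnitCubeSlice.corner C)) (toList S)
unitCubeSliceContaining {d} {e} 1≤d 1≤e m S S⊆m with e ≤? sumFin m | suc d + sumFin m ≤? e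
... | yes e≤Σm | _ = constantSlice 1≤d 1≤e m S (All.map (λ (β∈m , Σβ≡e) →
        (λ i → sym (≤-pointwise∧sumFin-≥⇒≗ (inUnitCube⇒≤ β∈m) (subst (_≤ sumFin m) (sym Σβ≡e) e≤Σm) i)) , Σβ≡e) S⊆m)
... | no _ | yes Σm+d≤e = constantSlice 1≤d 1≤e (suc ∘ m) S (All.map (λ (β∈m , Σβ≡e) →
        ≤-pointwise∧sumFin-≥⇒≗ (inUnitCube⇒≤suc β∈m) (subst₂ _≤_ (sym (sumFin-suc m)) (sym Σβ≡e) Σm+d≤e) , Σβ≡e) S⊆m)
... | no e≰Σm | no Σm+d≰e = record
  { corner = m ; lam = e ∸ sumFin m ; 1≤lam = m<n⇒0<n∸m Σm<e ; lam≤d = s≤s⁻¹ e∸Σm<1+d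
  ; Σcorner+lam≡e = m+[n∸m]≡n (<⇒≤ Σm<e) } , All.map proj₁ S⊆m
  where
  Σm<e : sumFin m < e
  Σm<e = ≰⇒> e≰Σm
  e∸Σm<1+d : e ∸ sumFin m < suc d
  e∸Σm<1+d = m<n+o⇒m∸n<o e (sumFin m) (subst (e <_) (+-comm (suc d) (sumFin m)) (≰⇒> Σm+d≰e))

lemma5p2 : (p e d : ℕ) → Prime p → 2 ≤ e → 2 ≤ d →
    (S : List⁺ (Fin d → ℕ)) →
    All (IsVertexExp d e) (toList S) →
    (∀ i → (maxAt S i ≡ minAt S i) ⊎ (maxAt S i ≡ suc (minAt S i))) →
    Σ (RegularFacet d e) λ F → All (OnFacet p F) (toList S)
lemma5p2 p e (suc d) _ 2≤e (s≤s 1≤d) S S-vertices M∈m =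
  let C , S⊆C = unitCubeSliceContaining 1≤d (≤-trans (n≤1+n 1) 2≤e) (minAt S) S S⊆m
      F , C-vertices⊆F = unitCubeFacet p C
  in  F , All.zipWith (λ (β∈C , β-vertex) → C-vertices⊆F β∈C β-vertex) (S⊆C , S-vertices)
  where
  S⊆m : All (λ β → InUnitCube (minAt S) β × IsVertexExp (suc d) e β) (toList S)
  S⊆m = All.tabulate λ β∈S →
    inUnitCube-squeeze M∈m (minAt-≤ S β∈S) (≤-maxAt S β∈S) , All.lookup S-vertices β∈S
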